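{- Let $\mathcal{D}$ be a $(v,k,\lambda)$-BIBD and let $\ell\geq k+1$ be an integer. A $0$-LSE $\ell$-colouring of $\mathcal{D}$ exists if and only if $\ell=v$.
   Context: For positive integers $v,k,\lambda$ with $2\le k<v$, a $(v,k,\lambda)$-BIBD is a pair $(V,\mathcal{B})$ where $V$ is a set of $v$ points and $\mathcal{B}$ is a collection of $k$-element subsets of $V$ (blocks) such that every pair of distinct points lies in exactly $\lambda$ blocks. An $\ell$-colouring is a surjective map from $V$ onto a set of $\ell$ colours (so $\ell\le v$); the colour class of a colour is the set of points mapped to it. A $0$-LSE $\ell$-colouring is an $\ell$-colouring such that in each block $B$, some colour does not appear in $B$, and for any two colours other than that colour, with colour classes $C_1,C_2$, $\big||C_1\cap B|-|C_2\cap B|\big|\le 1$. -}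

module Defs where

open import Data.Nat using (ℕ; _≤_; _<_; suc)
open import Data.Fin using (Fin; _≟_)
open import Data.Fin.Subset using (Subset; _∈_; ∣_∣; _∩_)
open import Data.Vec using (tabulate)
open import Data.List using (List; length; filter)
import Data.List.Membership.Propositional
open import Data.Product using (Σ; ∃; _×_)
open import Relation.Binary.PropositionalEquality using (_≡_; _≢_)
open import Relation.Nullary using (¬_; does)
open import Relation.Nullary.Decidable using (_×-dec_)
open import Data.Fin.Subset.Properties using (_∈?_)

-- Blocks are subsets of the point set Fin v; the collection of blocks is a
-- list (so repeated blocks are allowed, as in a general BIBD).

pairCount : ∀ {v} → List (Subset v) → Fin v → Fin v → ℕ
pairCount blocks x y = length (filter (λ B → (x ∈? B) ×-dec (y ∈? B)) blocks)

record IsBIBD (v k λ' : ℕ) (blocks : List (Subset v)) : Set where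
  field
    two≤k      : 2 ≤ k
    k<v        : k < v
    λ-positive : 1 ≤ λ'
    blockSize  : ∀ B → B Data.List.Membership.Propositional.∈ blocks → ∣ B ∣ ≡ k
    balanced   : ∀ (x y : Fin v) → x ≢ y → pairCount blocks x y ≡ λ'

IsColouring : ∀ {v ℓ} → (Fin v → Fin ℓ) → Set
IsColouring {ℓ = ℓ} c = ∀ (j : Fin ℓ) → ∃ λ i → c i ≡ j

colourClass : ∀ {v ℓ} → (Fin v → Fin ℓ) → Fin ℓ → Subset v
colourClass c j = tabulate (λ i → does (c i ≟ j))

countIn : ∀ {v ℓ} → (Fin v → Fin ℓ) → Fin ℓ → Subset v → ℕ
countIn c j B = ∣ colourClass c j ∩ B ∣

DiffAtMostOne : ℕ → ℕ → Set
DiffAtMostOne a b = (a ≤ suc b) × (b ≤ suc a)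

ZeroLSEBlock : ∀ {v ℓ} → (Fin v → Fin ℓ) → Subset v → Set
ZeroLSEBlock {ℓ = ℓ} c B =
  Σ (Fin ℓ) λ a →
    (∀ i → i ∈ B → c i ≢ a) ×
    (∀ (c₁ c₂ : Fin ℓ) → c₁ ≢ a → c₂ ≢ a →
       DiffAtMostOne (countIn c c₁ B) (countIn c c₂ B))

IsZeroLSEColouring : ∀ {v ℓ} → List (Subset v) → (Fin v → Fin ℓ) → Set
IsZeroLSEColouring blocks c =
  IsColouring c ×
  (∀ B → B Data.List.Membership.Propositional.∈ blocks → ZeroLSEBlock c B)

-- If ℓ < v, two distinct points x, y share a colour, and since λ ≥ 1 some block
-- B contains both. In B that colour occurs at least twice, so balance forces
-- each of the other ℓ − 1 non-missing colours to occur; picking one point of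
-- each, together with x and y, gives ℓ distinct points of B, so ℓ ≤ k < ℓ.
-- Conversely ℓ ≤ v by surjectivity, and for ℓ = v the identity colouring works:
-- every colour class is a singleton and k < v leaves a colour missing from B.
module Submission where

open import Defs
open import Data.Nat using (ℕ; suc; _≤_; _<_; _+_; z≤n; s≤s)
import Data.Nat.Properties as ℕ
open import Data.Fin using (Fin; _≟_; punchIn) renaming (zero to fzero; suc to fsuc)
import Data.Fin.Properties as Fin
open import Data.Fin.Subset using (Subset; Nonempty; _∈_; _∉_; ∣_∣; _∩_; _-_; ∁; ⁅_⁆)
open import Data.Fin.Subset.Properties
open import Data.Vec.Properties using (lookup∘tabulate; []=⇒lookup; lookup⇒[]=)
open import Data.List using (List; _∷_; length)
import Data.List.Membership.Propositional as List
open import Data.List.Membership.Propositional.Properties using (∈-filter⁻)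
open import Data.List.Relation.Unary.Any using (here)
open import Data.Product using (∃; _×_; _,_; proj₁; proj₂)
open import Data.Bool using (true)
open import Function using (id; _∘_)
open import Function.Bundles using (_⇔_; mk⇔)
open import Function.Definitions using (Injective)
open import Relation.Nullary using (¬_; Dec; yes; no; does; contradiction)
open import Relation.Nullary.Decidable using (dec-true; _×-dec_)
open import Relation.Binary.PropositionalEquality using (_≡_; _≢_; refl; sym; trans; cong; subst)

private
  variable
    n v ℓ : ℕ

does-true⇒ : ∀ {P : Set} (d : Dec P) → does d ≡ true → P
does-true⇒ (yes p) _ = p

∈-colourClass⁻ : (c : Fin v → Fin ℓ) {j : Fin ℓ} {x : Fin v} → x ∈ colourClass c j → c x ≡ j
∈-colourClass⁻ c {j} {x} x∈ =
  does-true⇒ (c x ≟ j) (trans (sym (lookup∘tabulate (λ i → does (c i ≟ j)) x)) ([]=⇒lookup x∈))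

∈-colourClass⁺ : (c : Fin v → Fin ℓ) {j : Fin ℓ} {x : Fin v} → c x ≡ j → x ∈ colourClass c j
∈-colourClass⁺ c {j} {x} cx≡j =
  lookup⇒[]= x (colourClass c j) (trans (lookup∘tabulate (λ i → does (c i ≟ j)) x) (dec-true (c x ≟ j) cx≡j))

∣p∣>0⇒Nonempty : {p : Subset n} → 0 < ∣ p ∣ → Nonempty p
∣p∣>0⇒Nonempty {n} {p} 0<∣p∣ with nonempty? p
... | yes ne = ne
... | no ¬ne = contradiction (trans (cong ∣_∣ (Empty-unique ¬ne)) (∣⊥∣≡0 n)) (ℕ.>⇒≢ 0<∣p∣)

∣p∣<n⇒∃∉ : {p : Subset n} → ∣ p ∣ < n → ∃ (_∉ p)
∣p∣<n⇒∃∉ {n} {p} ∣p∣<n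
  with x , x∈∁p ← ∣p∣>0⇒Nonempty (subst (0 <_) (sym (∣∁p∣≡n∸∣p∣ p)) (ℕ.m<n⇒0<n∸m ∣p∣<n))
  = x , x∈∁p⇒x∉p x∈∁p

x∈p∧y∈p∧x≢y⇒2≤∣p∣ : {p : Subset n} {x y : Fin n} → x ∈ p → y ∈ p → x ≢ y → 2 ≤ ∣ p ∣
x∈p∧y∈p∧x≢y⇒2≤∣p∣ x∈p y∈p x≢y =
  ℕ.≤-trans (s≤s (ℕ.m<n⇒0<n (x∈p⇒∣p-x∣<∣p∣ (x∈p∧x≢y⇒x∈p-y y∈p (x≢y ∘ sym))))) (x∈p⇒∣p-x∣<∣p∣ x∈p)

injective⇒≤∣p∣ : ∀ m {p : Subset n} {f : Fin m → Fin n} →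
  Injective _≡_ _≡_ f → (∀ i → f i ∈ p) → m ≤ ∣ p ∣
injective⇒≤∣p∣ 0 _ _ = z≤n
injective⇒≤∣p∣ (suc m) {f = f} f-inj f∈p =
  ℕ.≤-trans (s≤s (injective⇒≤∣p∣ m (Fin.suc-injective ∘ f-inj) f∘suc∈p-f₀)) (x∈p⇒∣p-x∣<∣p∣ (f∈p fzero))
  where
  f∘suc∈p-f₀ : ∀ i → f (fsuc i) ∈ _ - f fzero
  f∘suc∈p-f₀ i = x∈p∧x≢y⇒x∈p-y (f∈p (fsuc i)) (Fin.0≢1+n ∘ sym ∘ f-inj)

surjective⇒≤ : {f : Fin v → Fin ℓ} → IsColouring f → ℓ ≤ v
surjective⇒≤ {f = f} surj = Fin.injective⇒≤ {f = proj₁ ∘ surj}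
  (λ {i} {j} eq → trans (sym (proj₂ (surj i))) (trans (cong f eq) (proj₂ (surj j))))

length>0⇒∃∈ : ∀ {A : Set} {xs : List A} → 0 < length xs → ∃ (List._∈ xs)
length>0⇒∃∈ {xs = x ∷ _} _ = x , here refl

DiffAtMostOne-pos : ∀ {m n} → DiffAtMostOne m n → 2 ≤ m → 1 ≤ n
DiffAtMostOne-pos (m≤1+n , _) 2≤m = ℕ.≤-pred (ℕ.≤-trans 2≤m m≤1+n)

≤1⇒DiffAtMostOne : ∀ {m n} → m ≤ 1 → n ≤ 1 → DiffAtMostOne m n
≤1⇒DiffAtMostOne m≤1 n≤1 = ℕ.≤-trans m≤1 (s≤s z≤n) , ℕ.≤-trans n≤1 (s≤s z≤n)

module RepeatedColour {c : Fin v → Fin ℓ} {B : Subset v} (lse : ZeroLSEBlock c B)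
  {x y : Fin v} (x∈B : x ∈ B) (y∈B : y ∈ B) (x≢y : x ≢ y) (cx≡cy : c x ≡ c y) where

  a : Fin ℓ
  a = proj₁ lse

  cx≢a : c x ≢ a
  cx≢a = proj₁ (proj₂ lse) x x∈B

  2≤count : 2 ≤ countIn c (c x) B
  2≤count = x∈p∧y∈p∧x≢y⇒2≤∣p∣
    (x∈p∩q⁺ (∈-colourClass⁺ c refl , x∈B)) (x∈p∩q⁺ (∈-colourClass⁺ c (sym cx≡cy) , y∈B)) x≢y

  present : ∀ j → j ≢ a → 1 ≤ countIn c j B
  present j j≢a = DiffAtMostOne-pos (proj₂ (proj₂ lse) (c x) j cx≢a j≢a) 2≤count

  representative : ∀ j → j ≢ a → ∃ λ z → c z ≡ j × z ∈ B - x
  representative j j≢a with j ≟ c x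
  ... | yes j≡cx = y , trans (sym cx≡cy) (sym j≡cx) , x∈p∧x≢y⇒x∈p-y y∈B (x≢y ∘ sym)
  ... | no j≢cx
    with z , z∈ ← ∣p∣>0⇒Nonempty (present j j≢a)
    with z∈class , z∈B ← x∈p∩q⁻ _ B z∈
    = z , ∈-colourClass⁻ c z∈class
        , x∈p∧x≢y⇒x∈p-y z∈B (λ z≡x → j≢cx (trans (sym (∈-colourClass⁻ c z∈class)) (cong c z≡x)))

repeatedColour⇒ℓ≤∣B∣ : {c : Fin v → Fin ℓ} {B : Subset v} → ZeroLSEBlock c B →
  {x y : Fin v} → x ∈ B → y ∈ B → x ≢ y → c x ≡ c y → ℓ ≤ ∣ B ∣
repeatedColour⇒ℓ≤∣B∣ {ℓ = 0} (() , _) _ _ _ _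
repeatedColour⇒ℓ≤∣B∣ {ℓ = suc ℓ′} {c} lse {x} x∈B y∈B x≢y cx≡cy =
  ℕ.≤-trans (s≤s (injective⇒≤∣p∣ ℓ′ rep-injective (proj₂ ∘ proj₂ ∘ rep))) (x∈p⇒∣p-x∣<∣p∣ x∈B)
  where
  open RepeatedColour lse x∈B y∈B x≢y cx≡cy
  rep : ∀ i → ∃ λ z → c z ≡ punchIn a i × z ∈ _ - x
  rep i = representative (punchIn a i) (Fin.punchInᵢ≢i a i)
  rep-injective : Injective _≡_ _≡_ (proj₁ ∘ rep)
  rep-injective {i} {j} eq = Fin.punchIn-injective a i j
    (trans (sym (proj₁ (proj₂ (rep i)))) (trans (cong c eq) (proj₁ (proj₂ (rep j)))))

countIn-id≤1 : (j : Fin n) (B : Subset n) → countIn id j B ≤ 1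
countIn-id≤1 j B = subst (countIn id j B ≤_) (∣⁅x⁆∣≡1 j)
  (p⊆q⇒∣p∣≤∣q∣ (λ x∈ → subst (_∈ ⁅ j ⁆) (sym (∈-colourClass⁻ id (proj₁ (x∈p∩q⁻ _ B x∈)))) (x∈⁅x⁆ j)))

id-ZeroLSEBlock : {B : Subset n} → ∣ B ∣ < n → ZeroLSEBlock id B
id-ZeroLSEBlock {B = B} ∣B∣<n with a , a∉B ← ∣p∣<n⇒∃∉ ∣B∣<n
  = a , (λ i i∈B i≡a → a∉B (subst (_∈ B) i≡a i∈B))
      , λ j₁ j₂ _ _ → ≤1⇒DiffAtMostOne (countIn-id≤1 j₁ B) (countIn-id≤1 j₂ B)

module _ {v k λ′ : ℕ} {blocks : List (Subset v)} (bibd : IsBIBD v k λ′ blocks) where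
  open IsBIBD bibd

  distinctPoints⇒commonBlock : {x y : Fin v} → x ≢ y → ∃ λ B → B List.∈ blocks × x ∈ B × y ∈ B
  distinctPoints⇒commonBlock {x} {y} x≢y
    with B , B∈filter ← length>0⇒∃∈ (subst (0 <_) (sym (balanced x y x≢y)) λ-positive)
    = B , ∈-filter⁻ (λ B → (x ∈? B) ×-dec (y ∈? B)) B∈filter

  k<ℓ∧ZeroLSE⇒v≤ℓ : {ℓ : ℕ} → k < ℓ → {c : Fin v → Fin ℓ} → IsZeroLSEColouring blocks c → v ≤ ℓ
  k<ℓ∧ZeroLSE⇒v≤ℓ {ℓ} k<ℓ {c} (_ , lse) = ℕ.≮⇒≥ ℓ≮v
    where
    ℓ≮v : ¬ ℓ < v
    ℓ≮v ℓ<v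
      with x , y , x<y , cx≡cy ← Fin.pigeonhole ℓ<v c
      with B , B∈ , x∈B , y∈B ← distinctPoints⇒commonBlock (Fin.<⇒≢ x<y)
      = ℕ.<⇒≱ k<ℓ (subst (ℓ ≤_) (blockSize B B∈)
          (repeatedColour⇒ℓ≤∣B∣ (lse B B∈) x∈B y∈B (Fin.<⇒≢ x<y) cx≡cy))

  id-isZeroLSE : IsZeroLSEColouring blocks id
  id-isZeroLSE = (λ j → j , refl) , λ B B∈ → id-ZeroLSEBlock (subst (_< v) (sym (blockSize B B∈)) k<v)

lemma3p2 : ∀ (v k λ' : ℕ) (blocks : List (Subset v)) → IsBIBD v k λ' blocks →
    ∀ (ℓ : ℕ) → k + 1 ≤ ℓ →
    (∃ λ (c : Fin v → Fin ℓ) → IsZeroLSEColouring blocks c) ⇔ (ℓ ≡ v)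
lemma3p2 v k λ' blocks bibd ℓ k+1≤ℓ = mk⇔ to from
  where
  to : (∃ λ (c : Fin v → Fin ℓ) → IsZeroLSEColouring blocks c) → ℓ ≡ v
  to (c , lse@(surj , _)) =
    ℕ.≤-antisym (surjective⇒≤ surj) (k<ℓ∧ZeroLSE⇒v≤ℓ bibd (subst (_≤ ℓ) (ℕ.+-comm k 1) k+1≤ℓ) lse)
  from : ℓ ≡ v → ∃ λ (c : Fin v → Fin ℓ) → IsZeroLSEColouring blocks c
  from refl = id , id-isZeroLSE bibd
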